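{- Let $(\mathcal H,\mathcal L)$ be a strictly balanced pair of finite families of graphs. If $m_2(\mathcal L)<m_2(\mathcal H)$, then $m_2(\mathcal L)<m_2(\mathcal H,\mathcal L)<m_2(\mathcal H)$.
   Context: For a graph $J$, $v_J,e_J$ are its numbers of vertices and edges. For a graph $H$: $m_2(H)=\max\{(e_J-1)/(v_J-2): J\subseteq H, v_J\ge 3\}$ if $H$ has an edge and $v_H\ge3$; $m_2(K_2)=1/2$; $m_2(H)=0$ if $H$ has no edges. For a finite family $\mathcal H$, $m_2(\mathcal H)=\min_{H\in\mathcal H}m_2(H)$. For a graph $H$ and a family $\mathcal L$ (with $m_2(\mathcal L)>0$ so that the expression is defined), $m_2(H,\mathcal L)=\max\{e_J/(v_J-2+1/m_2(\mathcal L)): J\subseteq H, v_J\ge 2\}$, and $m_2(\mathcal H,\mathcal L)=\min_{H\in\mathcal H}m_2(H,\mathcal L)$. $(\mathcal H,\mathcal L)$ is strictly balanced if every $L\in\mathcal L$ satisfies $m_2(L')<m_2(L)$ for all proper subgraphs $L'\subsetneq L$, and every $H\in\mathcal H$ satisfies $m_2(H',\mathcal L)<m_2(H,\mathcal L)$ for all proper subgraphs $H'\subsetneq H$. -}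

module Defs where

open import Data.Bool using (Bool; true; false; _∧_)
open import Data.Nat as ℕ using (ℕ; zero; suc; _<ᵇ_)
open import Data.Integer as ℤ using (ℤ; +_)
open import Data.Rational as ℚ using (ℚ; 0ℚ; 1ℚ; ½; _÷_; _+_; _-_; _<_; _≤_; _≟_; ≢-nonZero)
open import Data.Fin using (Fin; toℕ)
open import Data.List using (List; map; allFin)
open import Data.Nat.ListAction using (sum)
open import Data.List.Membership.Propositional using (_∈_)
open import Data.Product using (Σ; _×_; _,_)
open import Data.Sum using (_⊎_)
open import Relation.Binary.PropositionalEquality using (_≡_)
open import Relation.Nullary using (¬_; yes; no)

-- A graph has vertex set Fin n; the (unordered) edge {i,j}, i ≠ j, is
-- present iff adj i j ≡ true for its representative with toℕ i < toℕ j.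
-- (Entries adj i j with toℕ i ≥ toℕ j are ignored.)

record Graph : Set where
  field
    n   : ℕ
    adj : Fin n → Fin n → Bool
open Graph public

-- A subgraph J of G: a set of vertices vs and a choice es of edges of G;
-- the edges of J are the chosen edges of G with both endpoints in vs.
record Sub (G : Graph) : Set where
  field
    vs : Fin (n G) → Bool
    es : Fin (n G) → Fin (n G) → Bool
open Sub public

whole : (G : Graph) → Sub G
whole G = record { vs = λ _ → true ; es = λ _ _ → true }

bit : Bool → ℕ
bit true  = 1
bit false = 0

edgeIn : {G : Graph} → Sub G → Fin (n G) → Fin (n G) → Bool
edgeIn {G} J i j = (toℕ i <ᵇ toℕ j) ∧ adj G i j ∧ es J i j ∧ vs J i ∧ vs J j

vCount : {G : Graph} → Sub G → ℕ
vCount {G} J = sum (map (λ i → bit (vs J i)) (allFin (n G)))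

eCount : {G : Graph} → Sub G → ℕ
eCount {G} J =
  sum (map (λ i → sum (map (λ j → bit (edgeIn J i j)) (allFin (n G)))) (allFin (n G)))

_⊑_ : {G : Graph} → Sub G → Sub G → Set
J ⊑ K = (∀ i → vs J i ≡ true → vs K i ≡ true)
      × (∀ i j → edgeIn J i j ≡ true → edgeIn K i j ≡ true)

_⊏_ : {G : Graph} → Sub G → Sub G → Set
J ⊏ K = J ⊑ K × ¬ (K ⊑ J)

ℕ→ℚ : ℕ → ℚ
ℕ→ℚ k = (+ k) ℚ./ 1

-- total division (x / 0 := 0); only ever used with nonzero divisors
_÷'_ : ℚ → ℚ → ℚ
p ÷' q with q ≟ 0ℚ
... | yes _ = 0ℚ
... | no q≢0 = _÷_ p q {{≢-nonZero q≢0}}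

IsM2 : {G : Graph} → Sub G → ℚ → Set
IsM2 K q =
    (eCount K ≡ 0 → q ≡ 0ℚ)
  × (1 ℕ.≤ eCount K → vCount K ≡ 2 → q ≡ ½)
  × (1 ℕ.≤ eCount K → 3 ℕ.≤ vCount K →
       Σ _ (λ J → J ⊑ K × 3 ℕ.≤ vCount J
              × q ≡ (ℕ→ℚ (eCount J) - 1ℚ) ÷' (ℕ→ℚ (vCount J) - ℕ→ℚ 2))
     × (∀ J → J ⊑ K → 3 ℕ.≤ vCount J →
              (ℕ→ℚ (eCount J) - 1ℚ) ÷' (ℕ→ℚ (vCount J) - ℕ→ℚ 2) ≤ q))

-- m₂(K, ℒ), where m stands for m₂(ℒ): "q is m₂(K, ℒ)"
IsM2Pair : {G : Graph} → Sub G → ℚ → ℚ → Set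
IsM2Pair K m q =
    Σ _ (λ J → J ⊑ K × 2 ℕ.≤ vCount J
           × q ≡ ℕ→ℚ (eCount J) ÷' ((ℕ→ℚ (vCount J) - ℕ→ℚ 2) + (1ℚ ÷' m)))
  × (∀ J → J ⊑ K → 2 ℕ.≤ vCount J →
           ℕ→ℚ (eCount J) ÷' ((ℕ→ℚ (vCount J) - ℕ→ℚ 2) + (1ℚ ÷' m)) ≤ q)

IsMinOver : List Graph → (Graph → ℚ → Set) → ℚ → Set
IsMinOver 𝓕 P q =
    Σ Graph (λ F → F ∈ 𝓕 × P F q)
  × (∀ F → F ∈ 𝓕 → ∀ r → P F r → q ≤ r)

IsM2Fam : List Graph → ℚ → Set
IsM2Fam 𝓗 = IsMinOver 𝓗 (λ H → IsM2 (whole H))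

-- "q is m₂(𝓗, 𝓛)", where m stands for m₂(𝓛)
IsM2FamPair : List Graph → ℚ → ℚ → Set
IsM2FamPair 𝓗 m = IsMinOver 𝓗 (λ H → IsM2Pair (whole H) m)

-- (𝓗, 𝓛) strictly balanced, where m stands for m₂(𝓛)
StrictlyBalanced : List Graph → List Graph → ℚ → Set
StrictlyBalanced 𝓗 𝓛 m =
    (∀ L → L ∈ 𝓛 → ∀ (L' : Sub L) → L' ⊏ whole L →
       ∀ a b → IsM2 L' a → IsM2 (whole L) b → a < b)
  × (∀ H → H ∈ 𝓗 → ∀ (H' : Sub H) → H' ⊏ whole H →
       ∀ a b → IsM2Pair H' m a → IsM2Pair (whole H) m b → a < b)

-- Write m = m₂(𝓛) > 0. For x > 0, x < e / (v − 2 + 1/m) iff x (v − 2) + x/m < e.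
-- Lower bound: let H₁ attain m₂(𝓗, 𝓛) and J ⊆ H₁ attain m₂(H₁) ≥ m₂(𝓗) > m (maxima exist since a
-- graph has finitely many subgraphs). Then m (v_J − 2) < e_J − 1, so by the equivalence with x = m the
-- density of J entering m₂(H₁, 𝓛) exceeds m.
-- Upper bound: let H₀ attain m₂(𝓗) = M. Every J ⊆ H₀ has e_J − 1 ≤ M (v_J − 2), and M/m > 1, so the
-- equivalence with x = M bounds every density entering m₂(H₀, 𝓛) strictly by M.
-- If H₁ has only two vertices then m₂(H₁) = ½ and m < ½, which is impossible: a positive m₂(L) is at
-- least ½, because two edges span at most four vertices.
{-# OPTIONS --safe #-}
module Submission where

open import Defs

module Sums where

  open import Data.Bool using (true; false; if_then_else_)
  open import Data.Nat using (ℕ; zero; suc; _+_; _≤_; z≤n; s≤s)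
  import Data.Nat.Properties as ℕP
  open import Data.Fin as Fin using (Fin)
  open import Data.Fin.Properties using (_≟_)
  open import Data.List using (List; []; _∷_; length; map; tabulate; allFin)
  open import Data.List.Properties using (map-cong; map-tabulate)
  open import Data.List.Relation.Unary.All as All using (All; []; _∷_)
  open import Data.List.Relation.Unary.AllPairs using ([]; _∷_)
  open import Data.List.Relation.Unary.Unique.Propositional using (Unique)
  open import Data.List.Membership.Propositional using (_∈_)
  import Data.List.Membership.DecPropositional as DecMembership
  open import Data.Nat.ListAction using (sum)
  open import Data.Product using (∃; _×_; _,_)
  open import Data.Sum using (_⊎_; inj₁; inj₂)
  open import Function using (_∘_; id)
  open import Relation.Binary.PropositionalEquality
  open import Relation.Nullary using (Dec; yes; no; does; contradiction)
  import Algebra.Properties.CommutativeSemigroup as CommSemigroupProperties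

  ∑ : ∀ {n} → (Fin n → ℕ) → ℕ
  ∑ {n} f = sum (map f (allFin n))

  ∑-suc : ∀ {n} (f : Fin (suc n) → ℕ) → ∑ f ≡ f Fin.zero + ∑ (f ∘ Fin.suc)
  ∑-suc f = begin
    sum (map f (tabulate id))                 ≡⟨ cong sum (map-tabulate id f) ⟩
    f Fin.zero + sum (tabulate (f ∘ Fin.suc))
      ≡⟨ cong (λ xs → f Fin.zero + sum xs) (map-tabulate id (f ∘ Fin.suc)) ⟨
    f Fin.zero + ∑ (f ∘ Fin.suc)              ∎
    where open ≡-Reasoning

  ∑-cong : ∀ {n} {f g : Fin n → ℕ} → (∀ i → f i ≡ g i) → ∑ f ≡ ∑ g
  ∑-cong {n} f≗g = cong sum (map-cong f≗g (allFin n))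

  ∑-mono : ∀ {n} {f g : Fin n → ℕ} → (∀ i → f i ≤ g i) → ∑ f ≤ ∑ g
  ∑-mono {zero}          f≤g = z≤n
  ∑-mono {suc n} {f} {g} f≤g = subst₂ _≤_ (sym (∑-suc f)) (sym (∑-suc g))
    (ℕP.+-mono-≤ (f≤g Fin.zero) (∑-mono (f≤g ∘ Fin.suc)))

  ∑-zero : ∀ n → ∑ {n} (λ _ → 0) ≡ 0
  ∑-zero zero    = refl
  ∑-zero (suc n) = trans (∑-suc {n} (λ _ → 0)) (∑-zero n)

  ∑-pos : ∀ {n} (f : Fin n → ℕ) → 1 ≤ ∑ f → ∃ λ i → 1 ≤ f i
  ∑-pos {zero}  f ()
  ∑-pos {suc n} f 1≤∑ with 1 ℕP.≤? f Fin.zero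
  ... | yes 1≤f0 = Fin.zero , 1≤f0
  ... | no 1≰f0 with ∑-pos (f ∘ Fin.suc)
        (subst (1 ≤_) (trans (∑-suc f) (cong (_+ ∑ (f ∘ Fin.suc)) (ℕP.n<1⇒n≡0 (ℕP.≰⇒> 1≰f0)))) 1≤∑)
  ...   | i , 1≤fi = Fin.suc i , 1≤fi

  erase : ∀ {n} → Fin n → (Fin n → ℕ) → Fin n → ℕ
  erase a f i = if does (i ≟ a) then 0 else f i

  erase-≢ : ∀ {n} {a i : Fin n} (f : Fin n → ℕ) → i ≢ a → erase a f i ≡ f i
  erase-≢ {a = a} {i} f i≢a with i ≟ a
  ... | yes i≡a = contradiction i≡a i≢a
  ... | no _    = refl

  erase-pos : ∀ {n} {a i : Fin n} (f : Fin n → ℕ) → 1 ≤ erase a f i → i ≢ a × 1 ≤ f i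
  erase-pos {a = a} {i} f 1≤fi with i ≟ a
  ... | no i≢a = i≢a , 1≤fi

  ∑-erase : ∀ {n} (f : Fin n → ℕ) a → ∑ f ≡ f a + ∑ (erase a f)
  ∑-erase {suc n} f Fin.zero = trans (∑-suc f) (cong (f Fin.zero +_) (sym (∑-suc (erase Fin.zero f))))
  ∑-erase {suc n} f (Fin.suc a) = begin
    ∑ f                                                     ≡⟨ ∑-suc f ⟩
    f Fin.zero + ∑ (f ∘ Fin.suc)                            ≡⟨ cong (f Fin.zero +_) (∑-erase (f ∘ Fin.suc) a) ⟩
    f Fin.zero + (f (Fin.suc a) + ∑ (erase a (f ∘ Fin.suc))) ≡⟨ x∙yz≈y∙xz (f Fin.zero) (f (Fin.suc a)) _ ⟩
    f (Fin.suc a) + (f Fin.zero + ∑ (erase a (f ∘ Fin.suc)))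
      ≡⟨ cong (f (Fin.suc a) +_) (∑-suc (erase (Fin.suc a) f)) ⟨
    f (Fin.suc a) + ∑ (erase (Fin.suc a) f)                 ∎
    where
      open ≡-Reasoning
      open CommSemigroupProperties ℕP.+-commutativeSemigroup using (x∙yz≈y∙xz)

  ≤-∑ : ∀ {n} (f : Fin n → ℕ) a → f a ≤ ∑ f
  ≤-∑ f a = subst (f a ≤_) (sym (∑-erase f a)) (ℕP.m≤m+n (f a) _)

  ∑-≥2 : ∀ {n} (f : Fin n → ℕ) → 2 ≤ ∑ f
       → (∃ λ i → 2 ≤ f i) ⊎ (∃ λ i → ∃ λ j → i ≢ j × 1 ≤ f i × 1 ≤ f j)
  ∑-≥2 f 2≤∑ with ∑-pos f (ℕP.≤-trans (ℕP.n≤1+n 1) 2≤∑)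
  ... | i , 1≤fi with 2 ℕP.≤? f i
  ...   | yes 2≤fi = inj₁ (i , 2≤fi)
  ...   | no 2≰fi with ∑-pos (erase i f) (rest-pos (ℕP.≤-antisym (ℕP.≤-pred (ℕP.≰⇒> 2≰fi)) 1≤fi))
    where
      rest-pos : f i ≡ 1 → 1 ≤ ∑ (erase i f)
      rest-pos fi≡1 = ℕP.+-cancelˡ-≤ 1 1 _
        (subst (2 ≤_) (trans (∑-erase f i) (cong (_+ ∑ (erase i f)) fi≡1)) 2≤∑)
  ...     | j , 1≤erased with erase-pos f 1≤erased
  ...       | j≢i , 1≤fj = inj₂ (i , j , j≢i ∘ sym , 1≤fi , 1≤fj)

  length≤∑ : ∀ {n} (f : Fin n → ℕ) {xs} → Unique xs → All (λ i → 1 ≤ f i) xs → length xs ≤ ∑ f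
  length≤∑ f [] [] = z≤n
  length≤∑ f {x ∷ xs} (x≢xs ∷ unique) (1≤fx ∷ 1≤fxs) = begin
    1 + length xs
      ≤⟨ ℕP.+-mono-≤ 1≤fx (length≤∑ (erase x f) unique (All.zipWith erased (x≢xs , 1≤fxs))) ⟩
    f x + ∑ (erase x f)  ≡⟨ ∑-erase f x ⟨
    ∑ f                  ∎
    where
      open ℕP.≤-Reasoning
      erased : ∀ {y} → x ≢ y × 1 ≤ f y → 1 ≤ erase x f y
      erased (x≢y , 1≤fy) = subst (1 ≤_) (sym (erase-≢ f (x≢y ∘ sym))) 1≤fy

  infix 4 _∈?_
  _∈?_ : ∀ {n} (i : Fin n) (xs : List (Fin n)) → Dec (i ∈ xs)
  _∈?_ = DecMembership._∈?_ _≟_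

  bit≤1 : ∀ b → bit b ≤ 1
  bit≤1 true  = s≤s z≤n
  bit≤1 false = z≤n

  ∑-∈?≤length : ∀ {n} (xs : List (Fin n)) → ∑ (λ i → bit (does (i ∈? xs))) ≤ length xs
  ∑-∈?≤length {n} []       = ℕP.≤-reflexive (∑-zero n)
  ∑-∈?≤length {n} (x ∷ xs) = begin
    ∑ f                            ≡⟨ ∑-erase f x ⟩
    f x + ∑ (erase x f)            ≤⟨ ℕP.+-mono-≤ (bit≤1 (does (x ∈? x ∷ xs))) (∑-mono erased≤) ⟩
    1 + ∑ (λ i → bit (does (i ∈? xs)))
                                   ≤⟨ ℕP.+-monoʳ-≤ 1 (∑-∈?≤length xs) ⟩
    1 + length xs                  ∎
    where
      open ℕP.≤-Reasoning
      f : Fin n → ℕ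
      f i = bit (does (i ∈? x ∷ xs))
      erased≤ : ∀ i → erase x f i ≤ bit (does (i ∈? xs))
      erased≤ i with i ≟ x
      ... | yes _ = z≤n
      ... | no _  = ℕP.≤-refl

module Subgraphs where

  open Sums
  open import Data.Bool using (Bool; true; false; T)
  open import Data.Nat using (ℕ; zero; suc; _≤_; _<_; _<ᵇ_; s≤s)
  import Data.Nat.Properties as ℕP
  open import Data.Fin using (Fin; toℕ)
  open import Data.Fin.Properties using (_≟_; <⇒≢)
  open import Data.Vec using (Vec; []; _∷_; lookup; tabulate)
  open import Data.Vec.Properties using (lookup∘tabulate)
  open import Data.List using (List; []; _∷_; length; filter; cartesianProductWith)
  open import Data.List.Relation.Unary.Any using (here; there)
  open import Data.List.Relation.Unary.All as All using (All; []; _∷_)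
  open import Data.List.Relation.Unary.All.Properties using (all-filter)
  open import Data.List.Relation.Unary.AllPairs using ([]; _∷_)
  open import Data.List.Relation.Unary.Unique.Propositional using (Unique)
  open import Data.List.Membership.Propositional using (_∈_)
  open import Data.List.Membership.Propositional.Properties using (∈-cartesianProductWith⁺; ∈-filter⁺)
  open import Data.Rational as ℚ using (ℚ)
  open import Data.Rational.Properties using (≤-decTotalOrder)
  open import Relation.Binary.Bundles using (DecTotalOrder)
  open import Data.List.Extrema (DecTotalOrder.totalOrder ≤-decTotalOrder)
    using (argmax; argmax-all; f[xs]≤f[argmax])
  open import Data.Product using (∃; _×_; _,_)
  open import Data.Product.Properties using (,-injectiveˡ; ,-injectiveʳ)
  open import Data.Sum using (inj₁; inj₂)
  open import Function using (_∘_)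
  open import Relation.Binary.PropositionalEquality
  open import Relation.Nullary using (yes; no; does; contradiction)
  open import Relation.Nullary.Decidable using (dec-true)

  1≤bit⇒≡true : ∀ {b} → 1 ≤ bit b → b ≡ true
  1≤bit⇒≡true {true} _ = refl

  ≡true⇒1≤bit : ∀ {b} → b ≡ true → 1 ≤ bit b
  ≡true⇒1≤bit refl = ℕP.≤-refl

  edgeIn-elim : ∀ {G} (J : Sub G) i j → edgeIn J i j ≡ true
              → (toℕ i <ᵇ toℕ j) ≡ true × adj G i j ≡ true × es J i j ≡ true
                × vs J i ≡ true × vs J j ≡ true
  edgeIn-elim {G} J i j ij with toℕ i <ᵇ toℕ j | adj G i j | es J i j | vs J i | vs J j | ij
  ... | true | true | true | true | true | _ = refl , refl , refl , refl , refl

  edgeIn-intro : ∀ {G} (J : Sub G) i j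
               → (toℕ i <ᵇ toℕ j) ≡ true → adj G i j ≡ true → es J i j ≡ true
               → vs J i ≡ true → vs J j ≡ true
               → edgeIn J i j ≡ true
  edgeIn-intro J i j p q r s t rewrite p | q | r | s | t = refl

  edge-endpoints : ∀ {G} (J : Sub G) i j → edgeIn J i j ≡ true
                 → toℕ i < toℕ j × vs J i ≡ true × vs J j ≡ true
  edge-endpoints J i j ij with edgeIn-elim J i j ij
  ... | i<ᵇj , _ , _ , i∈J , j∈J = ℕP.<ᵇ⇒< _ _ (subst T (sym i<ᵇj) _) , i∈J , j∈J

  ⊑-whole : ∀ {G} (J : Sub G) → J ⊑ whole G
  ⊑-whole {G} J = (λ _ _ → refl) , edge-whole
    where
      edge-whole : ∀ i j → edgeIn J i j ≡ true → edgeIn (whole G) i j ≡ true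
      edge-whole i j ij with edgeIn-elim J i j ij
      ... | i<ᵇj , ij∈G , _ = edgeIn-intro (whole G) i j i<ᵇj ij∈G refl refl refl

  vCount≤vCount-whole : ∀ {G} (J : Sub G) → vCount J ≤ vCount (whole G)
  vCount≤vCount-whole J = ∑-mono (λ i → bit≤1 (vs J i))

  an-edge : ∀ {G} (J : Sub G) → 1 ≤ eCount J → ∃ λ i → ∃ λ j → edgeIn J i j ≡ true
  an-edge J 1≤e with ∑-pos _ 1≤e
  ... | i , 1≤row with ∑-pos _ 1≤row
  ...   | j , 1≤ij = i , j , 1≤bit⇒≡true 1≤ij

  two-edges : ∀ {G} (J : Sub G) → 2 ≤ eCount J
            → ∃ λ a → ∃ λ b → ∃ λ c → ∃ λ d →
                edgeIn J a b ≡ true × edgeIn J c d ≡ true × (a , b) ≢ (c , d)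
  two-edges J 2≤e with ∑-≥2 _ 2≤e
  ... | inj₂ (a , c , a≢c , 1≤row-a , 1≤row-c) with ∑-pos _ 1≤row-a | ∑-pos _ 1≤row-c
  ...   | b , 1≤ab | d , 1≤cd =
    a , b , c , d , 1≤bit⇒≡true 1≤ab , 1≤bit⇒≡true 1≤cd , a≢c ∘ ,-injectiveˡ
  two-edges J 2≤e | inj₁ (a , 2≤row-a) with ∑-≥2 _ 2≤row-a
  ... | inj₁ (_ , 2≤bit) = contradiction 2≤bit (ℕP.<⇒≱ (s≤s (bit≤1 _)))
  ... | inj₂ (b , d , b≢d , 1≤ab , 1≤ad) =
    a , b , a , d , 1≤bit⇒≡true 1≤ab , 1≤bit⇒≡true 1≤ad , b≢d ∘ ,-injectiveʳ

  two-edges⇒2≤eCount : ∀ {G} (J : Sub G) a b c d → edgeIn J a b ≡ true → edgeIn J c d ≡ true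
                     → (a , b) ≢ (c , d) → 2 ≤ eCount J
  two-edges⇒2≤eCount J a b c d ab cd ab≢cd with a ≟ c
  ... | no a≢c = length≤∑ _ ((a≢c ∷ []) ∷ [] ∷ []) (1≤row a b ab ∷ 1≤row c d cd ∷ [])
    where
      1≤row : ∀ i j → edgeIn J i j ≡ true → 1 ≤ ∑ (λ k → bit (edgeIn J i k))
      1≤row i j ij = ℕP.≤-trans (≡true⇒1≤bit ij) (≤-∑ (λ k → bit (edgeIn J i k)) j)
  ... | yes refl = ℕP.≤-trans
    (length≤∑ _ ((b≢d ∷ []) ∷ [] ∷ []) (≡true⇒1≤bit ab ∷ ≡true⇒1≤bit cd ∷ []))
    (≤-∑ (λ i → ∑ (λ k → bit (edgeIn J i k))) a)
    where
      b≢d : b ≢ d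
      b≢d b≡d = ab≢cd (cong (a ,_) b≡d)

  three-distinct-endpoints : ∀ {n} {a b c d : Fin n} → toℕ a < toℕ b → toℕ c < toℕ d → (a , b) ≢ (c , d)
                           → ∃ λ xs → length xs ≡ 3 × Unique xs × All (_∈ a ∷ b ∷ c ∷ d ∷ []) xs
  three-distinct-endpoints {a = a} {b} {c} {d} a<b c<d ab≢cd with a ≟ c | b ≟ c
  ... | yes refl | _ = a ∷ b ∷ d ∷ [] , refl
    , (<⇒≢ a<b ∷ <⇒≢ c<d ∷ []) ∷ (b≢d ∷ []) ∷ [] ∷ []
    , here refl ∷ there (here refl) ∷ there (there (there (here refl))) ∷ []
    where
      b≢d : b ≢ d
      b≢d b≡d = ab≢cd (cong (a ,_) b≡d)
  ... | no _ | yes refl = a ∷ b ∷ d ∷ [] , refl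
    , (<⇒≢ a<b ∷ <⇒≢ (ℕP.<-trans a<b c<d) ∷ []) ∷ (<⇒≢ c<d ∷ []) ∷ [] ∷ []
    , here refl ∷ there (here refl) ∷ there (there (there (here refl))) ∷ []
  ... | no a≢c | no b≢c = a ∷ b ∷ c ∷ [] , refl
    , (<⇒≢ a<b ∷ a≢c ∷ []) ∷ (b≢c ∷ []) ∷ [] ∷ []
    , here refl ∷ there (here refl) ∷ there (there (here refl)) ∷ []

  two-edges⇒3≤vCount : ∀ {G} (J : Sub G) a b c d → edgeIn J a b ≡ true → edgeIn J c d ≡ true
                     → (a , b) ≢ (c , d) → 3 ≤ vCount J
  two-edges⇒3≤vCount J a b c d ab cd ab≢cd
    with edge-endpoints J a b ab | edge-endpoints J c d cd
  ... | a<b , a∈J , b∈J | c<d , c∈J , d∈J with three-distinct-endpoints a<b c<d ab≢cd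
  ...   | xs , ∣xs∣≡3 , unique , xs⊆abcd = subst (_≤ vCount J) ∣xs∣≡3
    (length≤∑ _ unique (All.map (≡true⇒1≤bit ∘ All.lookup (a∈J ∷ b∈J ∷ c∈J ∷ d∈J ∷ [])) xs⊆abcd))

  1≤eCount⇒2≤vCount : ∀ {G} (J : Sub G) → 1 ≤ eCount J → 2 ≤ vCount J
  1≤eCount⇒2≤vCount J 1≤e with an-edge J 1≤e
  ... | i , j , ij with edge-endpoints J i j ij
  ...   | i<j , i∈J , j∈J =
    length≤∑ _ ((<⇒≢ i<j ∷ []) ∷ [] ∷ []) (≡true⇒1≤bit i∈J ∷ ≡true⇒1≤bit j∈J ∷ [])

  2≤eCount⇒3≤vCount : ∀ {G} (J : Sub G) → 2 ≤ eCount J → 3 ≤ vCount J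
  2≤eCount⇒3≤vCount J 2≤e with two-edges J 2≤e
  ... | a , b , c , d , ab , cd , ab≢cd = two-edges⇒3≤vCount J a b c d ab cd ab≢cd

  span : ∀ {G} → Sub G → List (Fin (n G)) → Sub G
  span J xs = record { vs = λ i → does (i ∈? xs) ; es = es J }

  edgeIn-span : ∀ {G} (J : Sub G) {xs} a b → edgeIn J a b ≡ true → a ∈ xs → b ∈ xs
              → edgeIn (span J xs) a b ≡ true
  edgeIn-span J {xs} a b ab a∈xs b∈xs with edgeIn-elim J a b ab
  ... | a<ᵇb , ab∈G , ab∈J , _ =
    edgeIn-intro (span J xs) a b a<ᵇb ab∈G ab∈J (dec-true (a ∈? xs) a∈xs) (dec-true (b ∈? xs) b∈xs)

  two-edges-in-four-vertices : ∀ {G} (J : Sub G) → 2 ≤ eCount J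
                             → ∃ λ (K : Sub G) → 3 ≤ vCount K × vCount K ≤ 4 × 2 ≤ eCount K
  two-edges-in-four-vertices J 2≤e with two-edges J 2≤e
  ... | a , b , c , d , ab , cd , ab≢cd = K
    , two-edges⇒3≤vCount K a b c d abᴷ cdᴷ ab≢cd
    , ∑-∈?≤length abcd
    , two-edges⇒2≤eCount K a b c d abᴷ cdᴷ ab≢cd
    where
      abcd = a ∷ b ∷ c ∷ d ∷ []
      K = span J abcd
      abᴷ : edgeIn K a b ≡ true
      abᴷ = edgeIn-span J {abcd} a b ab (here refl) (there (here refl))
      cdᴷ : edgeIn K c d ≡ true
      cdᴷ = edgeIn-span J {abcd} c d cd (there (there (here refl))) (there (there (there (here refl))))

  vecsOver : ∀ {A : Set} → List A → (n : ℕ) → List (Vec A n)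
  vecsOver xs zero    = [] ∷ []
  vecsOver xs (suc n) = cartesianProductWith _∷_ xs (vecsOver xs n)

  ∈-vecsOver : ∀ {A : Set} {xs : List A} → (∀ x → x ∈ xs) → ∀ {n} (v : Vec A n) → v ∈ vecsOver xs n
  ∈-vecsOver ∈xs []      = here refl
  ∈-vecsOver ∈xs (x ∷ v) = ∈-cartesianProductWith⁺ _∷_ (∈xs x) (∈-vecsOver ∈xs v)

  ∈-bools : ∀ b → b ∈ true ∷ false ∷ []
  ∈-bools true  = here refl
  ∈-bools false = there (here refl)

  fromVecs : ∀ {G} → Vec Bool (n G) → Vec (Vec Bool (n G)) (n G) → Sub G
  fromVecs V E = record { vs = lookup V ; es = λ i → lookup (lookup E i) }

  subgraphs : (G : Graph) → List (Sub G)
  subgraphs G = cartesianProductWith fromVecs (vecsOver bools (n G)) (vecsOver (vecsOver bools (n G)) (n G))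
    where
      bools = true ∷ false ∷ []

  _≐_ : ∀ {G} → Sub G → Sub G → Set
  J ≐ K = (∀ i → vs J i ≡ vs K i) × (∀ i j → es J i j ≡ es K i j)

  -- A subgraph is a pair of functions, so the list can only contain it up to pointwise equality.
  subgraphs-complete : ∀ {G} (J : Sub G) → ∃ λ K → K ∈ subgraphs G × J ≐ K
  subgraphs-complete J = fromVecs V E
    , ∈-cartesianProductWith⁺ fromVecs (∈-vecsOver ∈-bools V) (∈-vecsOver (∈-vecsOver ∈-bools) E)
    , (λ i → sym (lookup∘tabulate (vs J) i))
    , (λ i j → sym (trans (cong (λ row → lookup row j) (lookup∘tabulate _ i))
                          (lookup∘tabulate (es J i) j)))
    where
      V = tabulate (vs J)
      E = tabulate (λ i → tabulate (es J i))

  vCount-cong : ∀ {G} {J K : Sub G} → J ≐ K → vCount J ≡ vCount K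
  vCount-cong (vs≗ , _) = ∑-cong (λ i → cong bit (vs≗ i))

  eCount-cong : ∀ {G} {J K : Sub G} → J ≐ K → eCount J ≡ eCount K
  eCount-cong {G} {J} {K} (vs≗ , es≗) = ∑-cong (λ i → ∑-cong (λ j → cong bit (edgeIn≗ i j)))
    where
      edgeIn≗ : ∀ i j → edgeIn {G} J i j ≡ edgeIn K i j
      edgeIn≗ i j rewrite vs≗ i | vs≗ j | es≗ i j = refl

  subgraph-argmax : ∀ G k (φ : ℕ → ℕ → ℚ) → k ≤ vCount (whole G)
    → ∃ λ (J : Sub G) → k ≤ vCount J
        × ∀ (K : Sub G) → k ≤ vCount K → φ (eCount K) (vCount K) ℚ.≤ φ (eCount J) (vCount J)
  subgraph-argmax G k φ k≤n =
    J* , argmax-all value {P = λ J → k ≤ vCount J} k≤n (all-filter _ (subgraphs G)) , J*-max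
    where
      value : Sub G → ℚ
      value J = φ (eCount J) (vCount J)
      candidates = filter (λ J → k ℕP.≤? vCount J) (subgraphs G)
      J* = argmax value (whole G) candidates
      J*-max : ∀ K → k ≤ vCount K → value K ℚ.≤ value J*
      J*-max K k≤K with subgraphs-complete K
      ... | K′ , K′∈ , K≐K′ =
        subst (ℚ._≤ value J*) (sym (cong₂ φ (eCount-cong {G} K≐K′) (vCount-cong {G} K≐K′)))
        (All.lookup (f[xs]≤f[argmax] {f = value} (whole G) candidates)
          (∈-filter⁺ _ K′∈ (subst (k ≤_) (vCount-cong {G} K≐K′) k≤K)))

open import Data.List using (List)
open import Data.Nat as ℕ using (ℕ; _∸_; z≤n)
import Data.Nat.Properties as ℕP
open import Data.Nat.Coprimality using (1-coprimeTo) renaming (sym to coprime-sym)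
import Data.Integer as ℤ
import Data.Integer.Properties as ℤP
open import Data.Rational
  using (ℚ; mkℚ; 0ℚ; 1ℚ; ½; _+_; _-_; _*_; 1/_; _<_; _≤_; _≟_; -_; *≤*; *<*; ≢-nonZero; positive)
open import Data.Rational.Properties
open import Algebra.Properties.Group +-0-group using (//-rightDividesˡ; //-rightDividesʳ)
open import Data.Product using (Σ; _×_; _,_; proj₂)
open import Data.Sum using (_⊎_; inj₁; inj₂)
open import Relation.Binary.PropositionalEquality
  using (_≡_; refl; sym; trans; cong; subst; subst₂; module ≡-Reasoning)
open import Relation.Nullary using (Dec; yes; no; contradiction)

open Subgraphs

ℕ→ℚ-mkℚ : ∀ k → ℕ→ℚ k ≡ mkℚ (ℤ.+ k) 0 (coprime-sym (1-coprimeTo k))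
ℕ→ℚ-mkℚ k = ↥p/↧p≡p (mkℚ (ℤ.+ k) 0 (coprime-sym (1-coprimeTo k)))

ℕ→ℚ-+ : ∀ a b → ℕ→ℚ (a ℕ.+ b) ≡ ℕ→ℚ a + ℕ→ℚ b
ℕ→ℚ-+ a b rewrite ℕ→ℚ-mkℚ a | ℕ→ℚ-mkℚ b | ℤP.*-identityʳ (ℤ.+ a) | ℤP.*-identityʳ (ℤ.+ b) = refl

ℕ→ℚ-mono-≤ : ∀ {a b} → a ℕ.≤ b → ℕ→ℚ a ≤ ℕ→ℚ b
ℕ→ℚ-mono-≤ {a} {b} a≤b rewrite ℕ→ℚ-mkℚ a | ℕ→ℚ-mkℚ b =
  *≤* (subst₂ ℤ._≤_ (sym (ℤP.*-identityʳ (ℤ.+ a))) (sym (ℤP.*-identityʳ (ℤ.+ b))) (ℤ.+≤+ a≤b))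

ℕ→ℚ-mono-< : ∀ {a b} → a ℕ.< b → ℕ→ℚ a < ℕ→ℚ b
ℕ→ℚ-mono-< {a} {b} a<b rewrite ℕ→ℚ-mkℚ a | ℕ→ℚ-mkℚ b =
  *<* (subst₂ ℤ._<_ (sym (ℤP.*-identityʳ (ℤ.+ a))) (sym (ℤP.*-identityʳ (ℤ.+ b))) (ℤ.+<+ a<b))

ℕ→ℚ-cancel-< : ∀ {a b} → ℕ→ℚ a < ℕ→ℚ b → a ℕ.< b
ℕ→ℚ-cancel-< {a} {b} a<b rewrite ℕ→ℚ-mkℚ a | ℕ→ℚ-mkℚ b with drop-*<* a<b
... | a*1<b*1 rewrite ℤP.*-identityʳ (ℤ.+ a) | ℤP.*-identityʳ (ℤ.+ b) = ℤP.drop‿+<+ a*1<b*1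

ℕ→ℚ-∸ : ∀ {k v} → k ℕ.≤ v → ℕ→ℚ v - ℕ→ℚ k ≡ ℕ→ℚ (v ∸ k)
ℕ→ℚ-∸ {k} {v} k≤v = begin
  ℕ→ℚ v - ℕ→ℚ k                 ≡⟨ cong (λ x → ℕ→ℚ x - ℕ→ℚ k) (ℕP.m∸n+n≡m k≤v) ⟨
  ℕ→ℚ (v ∸ k ℕ.+ k) - ℕ→ℚ k     ≡⟨ cong (_- ℕ→ℚ k) (ℕ→ℚ-+ (v ∸ k) k) ⟩
  (ℕ→ℚ (v ∸ k) + ℕ→ℚ k) - ℕ→ℚ k ≡⟨ //-rightDividesʳ (ℕ→ℚ k) (ℕ→ℚ (v ∸ k)) ⟩
  ℕ→ℚ (v ∸ k)                   ∎
  where open ≡-Reasoning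

÷'-*-cancel : ∀ p {r} → 0ℚ < r → (p ÷' r) * r ≡ p
÷'-*-cancel p {r} 0<r with r ≟ 0ℚ
... | yes r≡0 = contradiction (sym r≡0) (<⇒≢ 0<r)
... | no r≢0 = begin
  p * (1/ r) * r     ≡⟨ *-assoc p (1/ r) r ⟩
  p * ((1/ r) * r)   ≡⟨ cong (p *_) (*-inverseˡ r) ⟩
  p * 1ℚ             ≡⟨ *-identityʳ p ⟩
  p                  ∎
  where
    open ≡-Reasoning
    instance _ = ≢-nonZero r≢0

module DivisionByPositive {r : ℚ} (0<r : 0ℚ < r) where
  private instance
    r-pos = positive 0<r
    r-nonNeg = pos⇒nonNeg r

  p*r<q⇒p<q÷'r : ∀ {p q} → p * r < q → p < q ÷' r
  p*r<q⇒p<q÷'r {p} {q} p*r<q = *-cancelʳ-<-nonNeg r (subst (p * r <_) (sym (÷'-*-cancel q 0<r)) p*r<q)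

  q<p*r⇒q÷'r<p : ∀ {p q} → q < p * r → q ÷' r < p
  q<p*r⇒q÷'r<p {p} {q} q<p*r = *-cancelʳ-<-nonNeg r (subst (_< p * r) (sym (÷'-*-cancel q 0<r)) q<p*r)

  p*r≤q⇒p≤q÷'r : ∀ {p q} → p * r ≤ q → p ≤ q ÷' r
  p*r≤q⇒p≤q÷'r {p} {q} p*r≤q = *-cancelʳ-≤-pos r (subst (p * r ≤_) (sym (÷'-*-cancel q 0<r)) p*r≤q)

  q÷'r≤p⇒q≤p*r : ∀ {p q} → q ÷' r ≤ p → q ≤ p * r
  q÷'r≤p⇒q≤p*r {p} {q} q÷'r≤p = subst (_≤ p * r) (÷'-*-cancel q 0<r) (*-monoʳ-≤-nonNeg r q÷'r≤p)

  p<q÷'r⇒p*r<q : ∀ {p q} → p < q ÷' r → p * r < q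
  p<q÷'r⇒p*r<q {p} {q} p<q÷'r = subst (p * r <_) (÷'-*-cancel q 0<r) (*-monoˡ-<-pos r p<q÷'r)

open DivisionByPositive

d₂ : ℕ → ℕ → ℚ
d₂ e v = (ℕ→ℚ e - 1ℚ) ÷' (ℕ→ℚ v - ℕ→ℚ 2)

d₂-pair : ℚ → ℕ → ℕ → ℚ
d₂-pair m e v = ℕ→ℚ e ÷' ((ℕ→ℚ v - ℕ→ℚ 2) + (1ℚ ÷' m))

0<v-2 : ∀ {v} → 3 ℕ.≤ v → 0ℚ < ℕ→ℚ v - ℕ→ℚ 2
0<v-2 {v} 3≤v = subst (0ℚ <_) (sym (ℕ→ℚ-∸ (ℕP.≤-trans (ℕP.n≤1+n 2) 3≤v)))
  (ℕ→ℚ-mono-< {0} {v ∸ 2} (ℕP.m<n⇒0<n∸m 3≤v))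

0≤v-2 : ∀ {v} → 2 ℕ.≤ v → 0ℚ ≤ ℕ→ℚ v - ℕ→ℚ 2
0≤v-2 {v} 2≤v = subst (0ℚ ≤_) (sym (ℕ→ℚ-∸ 2≤v)) (ℕ→ℚ-mono-≤ {0} {v ∸ 2} z≤n)

module _ {m : ℚ} (0<m : 0ℚ < m) where

  0<1÷'m : 0ℚ < 1ℚ ÷' m
  0<1÷'m = p*r<q⇒p<q÷'r 0<m (subst (_< 1ℚ) (sym (*-zeroˡ m)) (positive⁻¹ 1ℚ))

  m*1÷'m≡1 : m * (1ℚ ÷' m) ≡ 1ℚ
  m*1÷'m≡1 = trans (*-comm m (1ℚ ÷' m)) (÷'-*-cancel 1ℚ 0<m)

  0<b+1÷'m : ∀ {b} → 0ℚ ≤ b → 0ℚ < b + (1ℚ ÷' m)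
  0<b+1÷'m {b} 0≤b = subst (_< b + (1ℚ ÷' m)) (+-identityˡ 0ℚ) (+-mono-≤-< 0≤b 0<1÷'m)

  m<d₂⇒m<d₂-pair : ∀ {e v} → 3 ℕ.≤ v → m < d₂ e v → m < d₂-pair m e v
  m<d₂⇒m<d₂-pair {e} {v} 3≤v m<d₂ = p*r<q⇒p<q÷'r (0<b+1÷'m (<⇒≤ (0<v-2 3≤v))) (begin-strict
    m * (b + 1ℚ ÷' m)      ≡⟨ *-distribˡ-+ m b (1ℚ ÷' m) ⟩
    m * b + m * (1ℚ ÷' m)  ≡⟨ cong (m * b +_) m*1÷'m≡1 ⟩
    m * b + 1ℚ             <⟨ +-monoˡ-< 1ℚ (p<q÷'r⇒p*r<q (0<v-2 3≤v) m<d₂) ⟩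
    (ℕ→ℚ e - 1ℚ) + 1ℚ      ≡⟨ //-rightDividesˡ 1ℚ (ℕ→ℚ e) ⟩
    ℕ→ℚ e                  ∎)
    where
      open ≤-Reasoning
      b = ℕ→ℚ v - ℕ→ℚ 2

  d₂-pair<M : ∀ {M e v} → m < M → 2 ℕ.≤ v → ℕ→ℚ e - 1ℚ ≤ M * (ℕ→ℚ v - ℕ→ℚ 2)
            → d₂-pair m e v < M
  d₂-pair<M {M} {e} {v} m<M 2≤v e-1≤M*b = q<p*r⇒q÷'r<p (0<b+1÷'m (0≤v-2 2≤v)) (begin-strict
    ℕ→ℚ e                  ≡⟨ //-rightDividesˡ 1ℚ (ℕ→ℚ e) ⟨
    (ℕ→ℚ e - 1ℚ) + 1ℚ      ≤⟨ +-monoˡ-≤ 1ℚ e-1≤M*b ⟩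
    M * b + 1ℚ             ≡⟨ cong (M * b +_) m*1÷'m≡1 ⟨
    M * b + m * (1ℚ ÷' m)  <⟨ +-monoʳ-< (M * b) (*-monoˡ-<-pos (1ℚ ÷' m) {{positive 0<1÷'m}} m<M) ⟩
    M * b + M * (1ℚ ÷' m)  ≡⟨ *-distribˡ-+ M b (1ℚ ÷' m) ⟨
    M * (b + 1ℚ ÷' m)      ∎)
    where
      open ≤-Reasoning
      b = ℕ→ℚ v - ℕ→ℚ 2

d₂≤M⇒e-1≤M*[v-2] : ∀ {M e v} → 3 ℕ.≤ v → d₂ e v ≤ M → ℕ→ℚ e - 1ℚ ≤ M * (ℕ→ℚ v - ℕ→ℚ 2)
d₂≤M⇒e-1≤M*[v-2] 3≤v = q÷'r≤p⇒q≤p*r (0<v-2 3≤v)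

e≤1⇒e-1≤M*[2-2] : ∀ {M e} → e ℕ.≤ 1 → ℕ→ℚ e - 1ℚ ≤ M * (ℕ→ℚ 2 - ℕ→ℚ 2)
e≤1⇒e-1≤M*[2-2] {M} {e} e≤1 = begin
  ℕ→ℚ e - 1ℚ           ≤⟨ +-monoˡ-≤ (- 1ℚ) (ℕ→ℚ-mono-≤ {e} {1} e≤1) ⟩
  1ℚ - 1ℚ              ≡⟨ +-inverseʳ 1ℚ ⟩
  0ℚ                   ≡⟨ *-zeroʳ M ⟨
  M * 0ℚ               ≡⟨ cong (M *_) (+-inverseʳ (ℕ→ℚ 2)) ⟨
  M * (ℕ→ℚ 2 - ℕ→ℚ 2)  ∎
  where open ≤-Reasoning

½≤d₂ : ∀ {e v} → 2 ℕ.≤ e → 3 ℕ.≤ v → v ℕ.≤ 4 → ½ ≤ d₂ e v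
½≤d₂ {e} {v} 2≤e 3≤v v≤4 = p*r≤q⇒p≤q÷'r (0<v-2 3≤v) (begin
  ½ * (ℕ→ℚ v - ℕ→ℚ 2)  ≡⟨ cong (½ *_) (ℕ→ℚ-∸ (ℕP.≤-trans (ℕP.n≤1+n 2) 3≤v)) ⟩
  ½ * ℕ→ℚ (v ∸ 2)      ≤⟨ *-monoˡ-≤-nonNeg ½ (ℕ→ℚ-mono-≤ {v ∸ 2} {2} (ℕP.∸-monoˡ-≤ 2 v≤4)) ⟩
  ½ * ℕ→ℚ 2            ≡⟨⟩
  1ℚ                   ≤⟨ ℕ→ℚ-mono-≤ {1} {e ∸ 1} (ℕP.∸-monoˡ-≤ 1 2≤e) ⟩
  ℕ→ℚ (e ∸ 1)          ≡⟨ ℕ→ℚ-∸ (ℕP.≤-trans (ℕP.n≤1+n 1) 2≤e) ⟨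
  ℕ→ℚ e - 1ℚ           ∎)
  where open ≤-Reasoning

0<d₂⇒2≤e : ∀ {e v} → 3 ℕ.≤ v → 0ℚ < d₂ e v → 2 ℕ.≤ e
0<d₂⇒2≤e {e} {v} 3≤v 0<d₂ = ℕ→ℚ-cancel-< {1} {e} (begin-strict
  1ℚ                              ≡⟨ cong (_+ 1ℚ) (*-zeroˡ (ℕ→ℚ v - ℕ→ℚ 2)) ⟨
  0ℚ * (ℕ→ℚ v - ℕ→ℚ 2) + 1ℚ       <⟨ +-monoˡ-< 1ℚ (p<q÷'r⇒p*r<q (0<v-2 3≤v) 0<d₂) ⟩
  (ℕ→ℚ e - 1ℚ) + 1ℚ               ≡⟨ //-rightDividesˡ 1ℚ (ℕ→ℚ e) ⟩
  ℕ→ℚ e                           ∎)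
  where open ≤-Reasoning

m₂-pos⇒1≤eCount : ∀ {H M} → IsM2 (whole H) M → 0ℚ < M → 1 ℕ.≤ eCount (whole H)
m₂-pos⇒1≤eCount (e≡0⇒M≡0 , _) 0<M = ℕP.n≢0⇒n>0 (λ e≡0 → <⇒≢ 0<M (sym (e≡0⇒M≡0 e≡0)))

vertex-cases : ∀ {G} (J : Sub G) → 1 ℕ.≤ eCount J → 3 ℕ.≤ vCount J ⊎ 2 ≡ vCount J
vertex-cases J 1≤e = ℕP.m≤n⇒m<n∨m≡n (1≤eCount⇒2≤vCount J 1≤e)

m₂-exists : (H : Graph) → Σ ℚ (IsM2 (whole H))
m₂-exists H = by-edges (eCount (whole H) ℕ.≟ 0)
  where
    by-edges : Dec (eCount (whole H) ≡ 0) → Σ ℚ (IsM2 (whole H))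
    by-edges (yes e≡0) = 0ℚ , (λ _ → refl) , (λ 1≤e → contradiction (sym e≡0) (ℕP.<⇒≢ 1≤e))
                            , (λ 1≤e → contradiction (sym e≡0) (ℕP.<⇒≢ 1≤e))
    by-edges (no e≢0) = by-vertices (vertex-cases (whole H) (ℕP.n≢0⇒n>0 e≢0))
      where
        by-vertices : 3 ℕ.≤ vCount (whole H) ⊎ 2 ≡ vCount (whole H) → Σ ℚ (IsM2 (whole H))
        by-vertices (inj₂ 2≡v) = ½ , (λ e≡0 → contradiction e≡0 e≢0) , (λ _ _ → refl)
                                   , (λ _ 3≤v → contradiction 2≡v (ℕP.<⇒≢ 3≤v))
        by-vertices (inj₁ 3≤v) =
          let J , 3≤vJ , J-max = subgraph-argmax H 3 d₂ 3≤v
          in d₂ (eCount J) (vCount J)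
             , (λ e≡0 → contradiction e≡0 e≢0) , (λ _ v≡2 → contradiction (sym v≡2) (ℕP.<⇒≢ 3≤v))
             , (λ _ _ → (J , ⊑-whole J , 3≤vJ , refl) , (λ K _ → J-max K))

m₂-pair-exists : ∀ m (H : Graph) → 2 ℕ.≤ vCount (whole H) → Σ ℚ (IsM2Pair (whole H) m)
m₂-pair-exists m H 2≤v =
  let J , 2≤vJ , J-max = subgraph-argmax H 2 (d₂-pair m) 2≤v
  in d₂-pair m (eCount J) (vCount J) , (J , ⊑-whole J , 2≤vJ , refl) , (λ K _ → J-max K)

½≤m₂ : ∀ {L M} → IsM2 (whole L) M → 0ℚ < M → ½ ≤ M
½≤m₂ {L} {M} m₂L@(_ , v≡2⇒M≡½ , v≥3⇒M≡max) 0<M = by-vertices (vertex-cases (whole L) 1≤e)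
  where
    1≤e = m₂-pos⇒1≤eCount m₂L 0<M
    by-vertices : 3 ℕ.≤ vCount (whole L) ⊎ 2 ≡ vCount (whole L) → ½ ≤ M
    by-vertices (inj₂ 2≡v) = ≤-reflexive (sym (v≡2⇒M≡½ 1≤e (sym 2≡v)))
    by-vertices (inj₁ 3≤v) =
      let (J , _ , 3≤vJ , M≡d₂J) , M-max = v≥3⇒M≡max 1≤e 3≤v
          2≤eJ = 0<d₂⇒2≤e {eCount J} 3≤vJ (subst (0ℚ <_) M≡d₂J 0<M)
          K , 3≤vK , vK≤4 , 2≤eK = two-edges-in-four-vertices J 2≤eJ
      in ≤-trans (½≤d₂ {eCount K} 2≤eK 3≤vK vK≤4) (M-max K (⊑-whole K) 3≤vK)

m<m₂⇒m<m₂-pair : ∀ {H m M q} → 0ℚ < m → ½ ≤ m → IsM2 (whole H) M → m < M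
               → IsM2Pair (whole H) m q → m < q
m<m₂⇒m<m₂-pair {H} {m} {M} {q} 0<m ½≤m m₂H@(_ , v≡2⇒M≡½ , v≥3⇒M≡max) m<M (_ , q-max) =
  by-vertices (vertex-cases (whole H) 1≤e)
  where
    1≤e = m₂-pos⇒1≤eCount m₂H (<-trans 0<m m<M)
    by-vertices : 3 ℕ.≤ vCount (whole H) ⊎ 2 ≡ vCount (whole H) → m < q
    by-vertices (inj₂ 2≡v) =
      contradiction (≤-<-trans ½≤m (subst (m <_) (v≡2⇒M≡½ 1≤e (sym 2≡v)) m<M)) (<-irrefl refl)
    by-vertices (inj₁ 3≤v) =
      let (J , _ , 3≤vJ , M≡d₂J) , _ = v≥3⇒M≡max 1≤e 3≤v
      in <-≤-trans (m<d₂⇒m<d₂-pair 0<m {eCount J} 3≤vJ (subst (m <_) M≡d₂J m<M))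
                   (q-max J (⊑-whole J) (ℕP.≤-trans (ℕP.n≤1+n 2) 3≤vJ))

m₂-pair<m₂ : ∀ {H m M q} → 0ℚ < m → m < M → IsM2 (whole H) M → IsM2Pair (whole H) m q → q < M
m₂-pair<m₂ {H} {m} {M} 0<m m<M m₂H@(_ , _ , v≥3⇒M≡max) ((J , _ , 2≤vJ , q≡d₂J) , _) =
  subst (_< M) (sym q≡d₂J)
    (d₂-pair<M 0<m {M} {eCount J} m<M 2≤vJ (numerator-bound (ℕP.m≤n⇒m<n∨m≡n 2≤vJ)))
  where
    1≤e = m₂-pos⇒1≤eCount m₂H (<-trans 0<m m<M)
    numerator-bound : 3 ℕ.≤ vCount J ⊎ 2 ≡ vCount J
                    → ℕ→ℚ (eCount J) - 1ℚ ≤ M * (ℕ→ℚ (vCount J) - ℕ→ℚ 2)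
    numerator-bound (inj₂ 2≡vJ) =
      subst (λ v → ℕ→ℚ (eCount J) - 1ℚ ≤ M * (ℕ→ℚ v - ℕ→ℚ 2)) 2≡vJ (e≤1⇒e-1≤M*[2-2] {M} {eCount J} eJ≤1)
      where
        eJ≤1 = ℕP.≮⇒≥ (λ 2≤eJ → ℕP.<⇒≢ (2≤eCount⇒3≤vCount J 2≤eJ) 2≡vJ)
    numerator-bound (inj₁ 3≤vJ) = d₂≤M⇒e-1≤M*[v-2] {M} {eCount J} 3≤vJ
      (proj₂ (v≥3⇒M≡max 1≤e (ℕP.≤-trans 3≤vJ (vCount≤vCount-whole J))) J (⊑-whole J) 3≤vJ)

lemma3p4 : (𝓗 𝓛 : List Graph) (m𝓗 m𝓛 m𝓗𝓛 : ℚ)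
         → IsM2Fam 𝓗 m𝓗
         → IsM2Fam 𝓛 m𝓛
         → 0ℚ < m𝓛
         → IsM2FamPair 𝓗 m𝓛 m𝓗𝓛
         → StrictlyBalanced 𝓗 𝓛 m𝓛
         → m𝓛 < m𝓗
         → (m𝓛 < m𝓗𝓛) × (m𝓗𝓛 < m𝓗)
lemma3p4 𝓗 𝓛 m𝓗 m𝓛 m𝓗𝓛 ((H₀ , H₀∈𝓗 , m₂H₀) , m𝓗-min) ((L , _ , m₂L) , _) 0<m𝓛
         ((H₁ , H₁∈𝓗 , m₂H₁𝓛) , m𝓗𝓛-min) _ m𝓛<m𝓗 =
  let M₁ , m₂H₁ = m₂-exists H₁
      2≤vH₀ = 1≤eCount⇒2≤vCount (whole H₀) (m₂-pos⇒1≤eCount m₂H₀ (<-trans 0<m𝓛 m𝓛<m𝓗))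
      q₀ , m₂H₀𝓛 = m₂-pair-exists m𝓛 H₀ 2≤vH₀
      m𝓛<M₁ = <-≤-trans m𝓛<m𝓗 (m𝓗-min H₁ H₁∈𝓗 M₁ m₂H₁)
  in m<m₂⇒m<m₂-pair 0<m𝓛 (½≤m₂ m₂L 0<m𝓛) m₂H₁ m𝓛<M₁ m₂H₁𝓛
   , ≤-<-trans (m𝓗𝓛-min H₀ H₀∈𝓗 q₀ m₂H₀𝓛) (m₂-pair<m₂ 0<m𝓛 m𝓛<m𝓗 m₂H₀ m₂H₀𝓛)
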